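{- Let $s,d$ be positive integers, $p$ an odd prime and $\alpha\ge 1$, and let $w=p^\alpha$. Then $\varphi(s,d,p^\alpha)=0$ if and only if either $\gcd(s,d,p)>1$, or $w=3$ and $3$ divides $s$.
   Context: For positive integers $s,d$ and an odd integer $w\ge 3$, let $S(s,d,w)=\{s,\,s+d,\,s+2d,\,\dots,\,s+\frac{w-3}{2}d\}$ and $\varphi(s,d,w)=|\{x\in S(s,d,w):\gcd(x,w)=1\}|$. -}

module Defs where

open import Data.Nat using (ℕ; _+_; _*_; _∸_; _/_)
open import Data.Nat.GCD using (gcd)
open import Data.Nat using (_≟_)
open import Data.List using (List; map; upTo; filter; length)

-- S(s,d,w) = { s + i*d : 0 ≤ i ≤ (w-3)/2 }, i.e. i ranges over 0 .. (w-1)/2 - 1.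
-- (For d > 0 these elements are pairwise distinct, so a list represents the set.)
S : ℕ → ℕ → ℕ → List ℕ
S s d w = map (λ i → s + i * d) (upTo ((w ∸ 1) / 2))

φ : ℕ → ℕ → ℕ → ℕ
φ s d w = length (filter (λ x → gcd x w ≟ 1) (S s d w))

gcd₃ : ℕ → ℕ → ℕ → ℕ
gcd₃ a b c = gcd (gcd a b) c

module Submission where

open import Defs
open import Data.Nat using (ℕ; _^_; _>_; _≥_)
open import Data.Nat.Divisibility using (_∣_)
open import Data.Nat.Primality using (Prime)
open import Data.Product using (_×_)
open import Data.Sum using (_⊎_)
open import Relation.Nullary using (¬_)
open import Relation.Binary.PropositionalEquality using (_≡_)
open import Function.Bundles using (_⇔_)

-- Write w = p^α and n = (w-1)/2, so that S(s,d,w) lists the n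
-- terms s + i·d (i < n).  Since p is prime, a number x fails to be coprime
-- to p^α exactly when p ∣ x; hence φ(s,d,w) = 0 iff p divides every term of
-- the progression.  As p is odd, w is an odd number ≥ 3, so n ≥ 1, and
-- n ≥ 2 unless w = 3.
--   * If n ≥ 2, p divides the first two terms s and s + d, i.e. p ∣ s and
--     p ∣ d, which for prime p is the condition gcd(s,d,p) > 1; conversely
--     p ∣ s, p ∣ d make every term a multiple of p.
--   * If w = 3 the progression is the single term s and p = 3.
-- The file first proves the list facts turning φ = 0 into a statement about
-- all i < n, then the facts about primes and prime powers (ending with
-- φ(s,d,p^α) = 0 ⇔ p divides every term), the parity count giving n, and the
-- divisibility facts about progressions; the theorem combines them.

open import Data.Nat hiding (_/_)
open import Data.Nat.DivMod using (_/_; /-monoˡ-≤)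
open import Data.Nat.Properties
open import Data.Nat.Divisibility
open import Data.Nat.GCD
open import Data.Nat.Coprimality using (Coprime; coprime-divisor; coprime⇒gcd≡1)
open import Data.Nat.Primality
open import Data.Product using (_,_)
open import Data.Sum using (inj₁; inj₂)
open import Data.List using (List; map; upTo; filter; length)
open import Data.List.Properties using (filter-none; filter-some)
open import Data.List.Relation.Unary.All using (All)
import Data.List.Relation.Unary.All.Properties as All
open import Relation.Nullary using (yes; no; contradiction)
open import Relation.Nullary.Decidable using (from-yes)
open import Relation.Unary using (Pred; Decidable; ∁)
open import Relation.Binary.PropositionalEquality
  using (refl; sym; subst; cong; _≢_)
open import Function.Base using (id; _∘_)
open import Function.Bundles using (mk⇔; Equivalence)
open Equivalence using (to; from)
import Function.Properties.Equivalence as ⇔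
open import Level using (Level)

module _ {a ℓ : Level} {A : Set a} {P : Pred A ℓ} (P? : Decidable P) where

  length-filter≡0⇔All∁ : ∀ (xs : List A) →
    length (filter P? xs) ≡ 0 ⇔ All (∁ P) xs
  length-filter≡0⇔All∁ xs = mk⇔ to′ (cong length ∘ filter-none P?)
    where
    to′ : length (filter P? xs) ≡ 0 → All (∁ P) xs
    to′ len≡0 = All.¬Any⇒All¬ xs (λ any → <⇒≢ (filter-some P? any) (sym len≡0))

All-map-upTo⇔ : ∀ {ℓ} {P : Pred ℕ ℓ} (f : ℕ → ℕ) (n : ℕ) →
  All P (map f (upTo n)) ⇔ (∀ {i} → i < n → P (f i))
All-map-upTo⇔ f n = mk⇔
  (All.applyUpTo⁻ id n ∘ All.map⁻)
  (λ Pf → All.map⁺ (All.applyUpTo⁺₁ id n Pf))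

φ≡0⇔ : ∀ s d w →
  φ s d w ≡ 0 ⇔ (∀ {i} → i < (w ∸ 1) / 2 → gcd (s + i * d) w ≢ 1)
φ≡0⇔ s d w =
  ⇔.trans (length-filter≡0⇔All∁ coprime? (S s d w)) (All-map-upTo⇔ term ((w ∸ 1) / 2))
  where
  term : ℕ → ℕ
  term i = s + i * d
  coprime? : Decidable (λ x → gcd x w ≡ 1)
  coprime? x = gcd x w ≟ 1

coprime-* : ∀ {x a b} → Coprime x a → Coprime x b → Coprime x (a * b)
coprime-* x⊥a x⊥b (i∣x , i∣ab) =
  x⊥b (i∣x , coprime-divisor (λ (j∣i , j∣a) → x⊥a (∣-trans j∣i i∣x , j∣a)) i∣ab)

coprime-^ : ∀ {x a} → Coprime x a → ∀ k → Coprime x (a ^ k)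
coprime-^ x⊥a zero    (_ , i∣1) = ∣1⇒≡1 i∣1
coprime-^ x⊥a (suc k) = coprime-* x⊥a (coprime-^ x⊥a k)

prime∤⇒coprime : ∀ {p x} → Prime p → ¬ p ∣ x → Coprime x p
prime∤⇒coprime p-prime p∤x (i∣x , i∣p) with prime⇒irreducible p-prime i∣p
... | inj₁ i≡1    = i≡1
... | inj₂ refl   = contradiction i∣x p∤x

gcd-prime-power≢1⇔ : ∀ {p x} → Prime p → ∀ β →
  gcd x (p ^ suc β) ≢ 1 ⇔ p ∣ x
gcd-prime-power≢1⇔ {p} {x} p-prime β = mk⇔ to′ from′
  where
  to′ : gcd x (p ^ suc β) ≢ 1 → p ∣ x
  to′ gcd≢1 with p ∣? x
  ... | yes p∣x = p∣x
  ... | no  p∤x =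
    contradiction (coprime⇒gcd≡1 (coprime-^ (prime∤⇒coprime p-prime p∤x) (suc β))) gcd≢1
  from′ : p ∣ x → gcd x (p ^ suc β) ≢ 1
  from′ p∣x gcd≡1 = <⇒≢ (nonTrivial⇒n>1 p {{prime⇒nonTrivial p-prime}})
    (sym (∣1⇒≡1 (subst (p ∣_) gcd≡1 (gcd-greatest p∣x (m∣m*n (p ^ β))))))

φ-prime-power≡0⇔ : ∀ s d {p} → Prime p → ∀ β →
  φ s d (p ^ suc β) ≡ 0 ⇔ (∀ {i} → i < (p ^ suc β ∸ 1) / 2 → p ∣ s + i * d)
φ-prime-power≡0⇔ s d {p} p-prime β = mk⇔ to′ from′
  where
  w = p ^ suc β
  AllDivisible : Set
  AllDivisible = ∀ {i} → i < (w ∸ 1) / 2 → p ∣ s + i * d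
  not-coprime⇔divisible : ∀ {x} → gcd x w ≢ 1 ⇔ p ∣ x
  not-coprime⇔divisible = gcd-prime-power≢1⇔ p-prime β
  to′ : φ s d w ≡ 0 → AllDivisible
  to′ φ≡0 i<n = to not-coprime⇔divisible (to (φ≡0⇔ s d w) φ≡0 i<n)
  from′ : AllDivisible → φ s d w ≡ 0
  from′ all = from (φ≡0⇔ s d w) (λ i<n → from not-coprime⇔divisible (all i<n))

gcd-prime>1⇔ : ∀ {p} m → Prime p → 1 < gcd m p ⇔ p ∣ m
gcd-prime>1⇔ {p} m p-prime = mk⇔ to′ from′
  where
  to′ : 1 < gcd m p → p ∣ m
  to′ gcd>1 with prime⇒irreducible p-prime (gcd[m,n]∣n m p)
  ... | inj₁ gcd≡1 = contradiction gcd≡1 (>⇒≢ gcd>1)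
  ... | inj₂ gcd≡p = subst (_∣ m) gcd≡p (gcd[m,n]∣m m p)
  from′ : p ∣ m → 1 < gcd m p
  from′ p∣m = subst (1 <_)
    (∣-antisym (gcd-greatest p∣m ∣-refl) (gcd[m,n]∣n m p))
    (nonTrivial⇒n>1 p {{prime⇒nonTrivial p-prime}})

gcd₃>1⇔ : ∀ s d {p} → Prime p → gcd₃ s d p > 1 ⇔ (p ∣ s × p ∣ d)
gcd₃>1⇔ s d p-prime = mk⇔
  (λ g>1 → let p∣gcd = to (gcd-prime>1⇔ (gcd s d) p-prime) g>1 in
    ∣-trans p∣gcd (gcd[m,n]∣m s d) , ∣-trans p∣gcd (gcd[m,n]∣n s d))
  (λ (p∣s , p∣d) → from (gcd-prime>1⇔ (gcd s d) p-prime) (gcd-greatest p∣s p∣d))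

prime∣prime⇒≡ : ∀ {p q} → Prime p → Prime q → p ∣ q → p ≡ q
prime∣prime⇒≡ {p} p-prime q-prime p∣q with prime⇒irreducible q-prime p∣q
... | inj₁ p≡1 = contradiction p≡1 (>⇒≢ (nonTrivial⇒n>1 p {{prime⇒nonTrivial p-prime}}))
... | inj₂ p≡q = p≡q

odd-^ : ∀ {m} → ¬ 2 ∣ m → ∀ k → ¬ 2 ∣ m ^ k
odd-^ m-odd zero    2∣1      = contradiction (∣1⇒≡1 2∣1) (λ ())
odd-^ {m} m-odd (suc k) 2∣m^sk with euclidsLemma m (m ^ k) prime[2] 2∣m^sk
... | inj₁ 2∣m   = m-odd 2∣m
... | inj₂ 2∣m^k = odd-^ m-odd k 2∣m^k

odd-half-length : ∀ w → 1 < w → ¬ 2 ∣ w →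
  1 ≤ (w ∸ 1) / 2 × (w ≡ 3 ⊎ 2 ≤ (w ∸ 1) / 2)
odd-half-length 1 (s≤s ()) _
odd-half-length 2 _ w-odd = contradiction ∣-refl w-odd
odd-half-length 3 _ _     = ≤-refl , inj₁ refl
odd-half-length 4 _ w-odd = contradiction (divides 2 refl) w-odd
odd-half-length (suc (suc (suc (suc (suc k))))) _ _ = ≤-trans (s≤s z≤n) n≥2 , inj₂ n≥2
  where
  n≥2 : 2 ≤ (4 + k) / 2
  n≥2 = /-monoˡ-≤ 2 (m≤m+n 4 k)

progression-divisible : ∀ {p s d} → p ∣ s → p ∣ d → ∀ i → p ∣ s + i * d
progression-divisible p∣s p∣d i = ∣m∣n⇒∣m+n p∣s (∣-trans p∣d (n∣m*n i))

single-term-divisible : ∀ {p s d i} → p ∣ s → i < 1 → p ∣ s + i * d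
single-term-divisible {s = s} p∣s (s≤s z≤n) = subst (_ ∣_) (sym (+-identityʳ s)) p∣s

module _ {p s d n : ℕ} (all-divisible : ∀ {i} → i < n → p ∣ s + i * d) where

  first-term-divisible : 1 ≤ n → p ∣ s
  first-term-divisible n≥1 = subst (p ∣_) (+-identityʳ s) (all-divisible n≥1)

  difference-divisible : 2 ≤ n → p ∣ d
  difference-divisible n≥2 = ∣m+n∣m⇒∣n p∣s+d (first-term-divisible (≤-trans (s≤s z≤n) n≥2))
    where
    p∣s+d : p ∣ s + d
    p∣s+d = subst (λ t → p ∣ s + t) (*-identityˡ d) (all-divisible n≥2)

lemma4p7 : (s d p α : ℕ) → s > 0 → d > 0 → Prime p → ¬ (2 ∣ p) → α ≥ 1 →
    (φ s d (p ^ α) ≡ 0 ⇔ (gcd₃ s d p > 1 ⊎ (p ^ α ≡ 3 × 3 ∣ s)))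
lemma4p7 s d p (suc β) _ _ p-prime p-odd _ =
  ⇔.trans (φ-prime-power≡0⇔ s d p-prime β) (mk⇔ divisible⇒ ⇒divisible)
  where
  w = p ^ suc β
  n = (w ∸ 1) / 2

  p∣w : p ∣ w
  p∣w = m∣m*n (p ^ β)

  w>1 : 1 < w
  w>1 = <-≤-trans (nonTrivial⇒n>1 p {{prime⇒nonTrivial p-prime}})
          (∣⇒≤ {{m^n≢0 p (suc β) {{prime⇒nonZero p-prime}}}} p∣w)

  p≡3 : w ≡ 3 → p ≡ 3
  p≡3 w≡3 = prime∣prime⇒≡ p-prime (from-yes (prime? 3)) (subst (p ∣_) w≡3 p∣w)

  divisible⇒ : (∀ {i} → i < n → p ∣ s + i * d) → gcd₃ s d p > 1 ⊎ (w ≡ 3 × 3 ∣ s)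
  divisible⇒ all with odd-half-length w w>1 (odd-^ p-odd (suc β))
  ... | n≥1 , inj₁ w≡3 = inj₂ (w≡3 , subst (_∣ s) (p≡3 w≡3) (first-term-divisible all n≥1))
  ... | n≥1 , inj₂ n≥2 = inj₁ (from (gcd₃>1⇔ s d p-prime)
                           (first-term-divisible all n≥1 , difference-divisible all n≥2))

  ⇒divisible : gcd₃ s d p > 1 ⊎ (w ≡ 3 × 3 ∣ s) → ∀ {i} → i < n → p ∣ s + i * d
  ⇒divisible (inj₁ gcd₃>1) {i} _ =
    let (p∣s , p∣d) = to (gcd₃>1⇔ s d p-prime) gcd₃>1 in progression-divisible p∣s p∣d i
  ⇒divisible (inj₂ (w≡3 , 3∣s)) {i} i<n =
    single-term-divisible {d = d} (subst (_∣ s) (sym (p≡3 w≡3)) 3∣s)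
      (subst (i <_) (cong (λ v → (v ∸ 1) / 2) w≡3) i<n)
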